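{- Let $h$ and $t$ be positive integers and for $a\in\{0,\ldots,t\}$ let $\ell_a=\lceil h/(t+a+1)\rceil$. If $h\ge(t+1)^2+1$, then for all $p\in[1/2,1]$, \[\frac{1-p}{\ell_0-1}\le\frac{p}{t+1}.\] For $a\in\{1,\ldots,t\}$, if $h\ge(t+1)(t+a)+1$, then for all $p\in[1/2,1]$, \[\frac{1-p}{\ell_0-1}\le\frac{p(1-p)}{a(1-p)+(\ell_a-1)p}.\]
   Formalization: The variable p ranges only over rational numbers in $[1/2,1]$. -}

module Defs where

open import Data.Nat as ℕ using (ℕ; suc; NonZero; _∸_)
open import Data.Nat.DivMod using () renaming (_/_ to _/ℕ_)
open import Data.Rational as ℚ using (ℚ; 0ℚ; 1ℚ; _÷_)
open import Data.Rational.Properties as ℚP using (_≟_)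
open import Relation.Nullary using (yes; no)
import Data.Integer

⌈_/_⌉ : ℕ → (n : ℕ) → .{{NonZero n}} → ℕ
⌈ m / n ⌉ = (m ℕ.+ (n ∸ 1)) /ℕ n

-- Total division on ℚ (x / 0 := 0). Only used where the denominator is
-- provably positive under the hypotheses, so the convention is irrelevant.
_/₀_ : ℚ → ℚ → ℚ
x /₀ y with y ≟ 0ℚ
... | yes _ = 0ℚ
... | no y≢0 = _÷_ x y {{ℚ.≢-nonZero y≢0}}

ℓ : (h t a : ℕ) → ℕ
ℓ h t a = ⌈ h / suc (t ℕ.+ a) ⌉

fromℕ : ℕ → ℚ
fromℕ n = Data.Integer.+ n ℚ./ 1

-- The proof separates integer arithmetic (module CeilingArithmetic) from
-- rational inequalities.
--  * Ceilings.  m < ⌈h/(k+1)⌉ holds exactly when m(k+1) < h.  From this: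
--    ℓ₀ ≥ t+2 when h > (t+1)²;  and when h > (t+1)(t+a) (t ≥ 1) we get
--    ℓₐ ≥ 2 and ℓₐ + a ≤ ℓ₀.  The last one is the heart of the fact:
--    writing ℓₐ = c+1 we know c(t+a+1) < h, and (c+a)(t+1) is bounded by
--    (t+a)(t+1) when c ≤ t and by c(t+a+1) when c > t.
--  * Rationals.  With q = 1-p we have 0 ≤ q ≤ p.  Cross-multiplying,
--    q/y ≤ p/z whenever 0 < z ≤ y, and q/Y ≤ pq/(Aq+Bp) whenever A ≥ 0,
--    B > 0, A + B ≤ Y, since q(Aq+Bp) ≤ pq(A+B).
-- The first claim is the first comparison with y = ℓ₀-1, z = t+1; the
-- second is the second comparison with A = a, B = ℓₐ-1, Y = ℓ₀-1.
module Submission where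

open import Defs
open import Data.Nat as ℕ using (ℕ; suc; _^_)
open import Data.Product using (_×_; _,_)
open import Relation.Binary.PropositionalEquality
open import Relation.Nullary using (yes; no)

module CeilingArithmetic where

  open import Data.Nat
  open import Data.Nat.Properties
  open import Data.Nat.DivMod using (m*n/n≡m; m/n*n≤m; /-monoˡ-≤)
  open import Data.Nat.Tactic.RingSolver using (solve-∀)

  <-⌈/⌉ : ∀ {m h} k → m * suc k < h → m < ⌈ h / suc k ⌉
  <-⌈/⌉ {m} {h} k m[k+1]<h = begin
    suc m                         ≡⟨ m*n/n≡m (suc m) (suc k) ⟨
    (suc k + m * suc k) / suc k   ≤⟨ /-monoˡ-≤ (suc k) numerator-≤ ⟩
    (h + k) / suc k               ∎
    where
    open ≤-Reasoning
    numerator-≤ : suc k + m * suc k ≤ h + k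
    numerator-≤ = subst (_≤ h + k) (cong suc (+-comm (m * suc k) k)) (+-monoˡ-≤ k m[k+1]<h)

  ⌈/⌉-< : ∀ {m h} k → m < ⌈ h / suc k ⌉ → m * suc k < h
  ⌈/⌉-< {m} {h} k m<⌈h/k+1⌉ = +-cancelʳ-≤ k (suc (m * suc k)) h (begin
    suc (m * suc k) + k     ≡⟨ cong suc (+-comm (m * suc k) k) ⟩
    suc m * suc k           ≤⟨ *-monoˡ-≤ (suc k) m<⌈h/k+1⌉ ⟩
    ⌈ h / suc k ⌉ * suc k   ≤⟨ m/n*n≤m (h + k) (suc k) ⟩
    h + k                   ∎)
    where open ≤-Reasoning

  -- If c(t+a+1) and (t+a)(t+1) are both below h, so is (c+a)(t+1):
  -- for c ≤ t compare with the second product, for c > t with the first.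
  shifted-product-< : ∀ {h} c a t → c * suc (t + a) < h → (t + a) * suc t < h →
                      (c + a) * suc t < h
  shifted-product-< c a t c[t+a+1]<h [t+a][t+1]<h with c ≤? t
  ... | yes c≤t = ≤-<-trans (*-monoˡ-≤ (suc t) (+-monoˡ-≤ a c≤t)) [t+a][t+1]<h
  ... | no  c≰t = ≤-<-trans (begin
    (c + a) * suc t         ≡⟨ *-distribʳ-+ (suc t) c a ⟩
    c * suc t + a * suc t   ≤⟨ +-monoʳ-≤ (c * suc t) (*-monoʳ-≤ a (≰⇒> c≰t)) ⟩
    c * suc t + a * c       ≡⟨ regroup c a t ⟩
    c * suc (t + a)         ∎) c[t+a+1]<h
    where
    open ≤-Reasoning
    regroup : ∀ c a t → c * suc t + a * c ≡ c * suc (t + a)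
    regroup = solve-∀

  <-*-suc : ∀ {m n} → 1 ≤ m → 1 ≤ n → m < m * suc n
  <-*-suc {m} {n} 1≤m 1≤n = begin
    suc m         ≡⟨ +-comm 1 m ⟩
    m + 1         ≤⟨ +-monoʳ-≤ m (*-mono-≤ 1≤m 1≤n) ⟩
    m + m * n     ≡⟨ *-suc m n ⟨
    m * suc n     ∎
    where open ≤-Reasoning

  -- The paper's hypotheses, rewritten as strict bounds on products.
  square-form : ∀ t → (t + 1) ^ 2 + 1 ≡ suc ((t + 1) * suc t)
  square-form t = expanded t
    where
    expanded : ∀ t → (t + 1) * ((t + 1) * 1) + 1 ≡ suc ((t + 1) * suc t)
    expanded = solve-∀

  product-form : ∀ t a → (t + 1) * (t + a) + 1 ≡ suc ((t + a) * suc t)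
  product-form = solve-∀

  ℓ-zero : ∀ h t → ℓ h t 0 ≡ ⌈ h / suc t ⌉
  ℓ-zero h t = cong (λ n → ⌈ h / suc n ⌉) (+-identityʳ t)

  ℓ₀-large : ∀ h t → (t + 1) ^ 2 + 1 ≤ h → t + 1 < ℓ h t 0
  ℓ₀-large h t hyp = subst (t + 1 <_) (sym (ℓ-zero h t))
    (<-⌈/⌉ t (subst (_≤ h) (square-form t) hyp))

  -- h > (t+1)(t+a) with t ≥ 1 gives ℓₐ ≥ 2, since then t+a+1 ≤ (t+a)(t+1) < h.
  ℓₐ-≥2 : ∀ h t a → 1 ≤ t → (t + 1) * (t + a) + 1 ≤ h → 1 < ℓ h t a
  ℓₐ-≥2 h t a 1≤t hyp = <-⌈/⌉ (t + a) (begin-strict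
    1 * suc (t + a)     ≡⟨ *-identityˡ (suc (t + a)) ⟩
    suc (t + a)         ≤⟨ <-*-suc (≤-trans 1≤t (m≤m+n t a)) 1≤t ⟩
    (t + a) * suc t     <⟨ subst (_≤ h) (product-form t a) hyp ⟩
    h                   ∎)
    where open ≤-Reasoning

  ⌈/⌉-shift : ∀ h t a → (t + a) * suc t < h → ⌈ h / suc (t + a) ⌉ + a ≤ ⌈ h / suc t ⌉
  ⌈/⌉-shift h t a [t+a][t+1]<h with ⌈ h / suc (t + a) ⌉ in ceiling≡
  ... | zero  = ≤-trans (m≤n+m a t) (<⇒≤ (<-⌈/⌉ t [t+a][t+1]<h))
  ... | suc c = <-⌈/⌉ t (shifted-product-< c a t c[t+a+1]<h [t+a][t+1]<h)
    where
    c[t+a+1]<h : c * suc (t + a) < h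
    c[t+a+1]<h = ⌈/⌉-< (t + a) (subst (c <_) (sym ceiling≡) (n<1+n c))

  ℓ-shift : ∀ h t a → (t + 1) * (t + a) + 1 ≤ h → ℓ h t a + a ≤ ℓ h t 0
  ℓ-shift h t a hyp = subst (ℓ h t a + a ≤_) (sym (ℓ-zero h t))
    (⌈/⌉-shift h t a (subst (_≤ h) (product-form t a) hyp))

open CeilingArithmetic

open import Data.Rational as ℚ using (ℚ; 1ℚ; ½; _-_; _*_; _+_; _≤_)
import Data.Nat.Properties as ℕP
import Data.Integer as ℤ
import Data.Integer.Properties as ℤP
open import Data.Rational using (0ℚ; _<_; 1/_; NonNegative)
import Data.Rational.Properties as ℚP
import Data.Rational.Unnormalised as ℚᵘ
import Data.Rational.Unnormalised.Properties as ℚᵘP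
open import Data.Rational.Solver using (module +-*-Solver)
open import Relation.Nullary.Negation using (contradiction)


fromℕ-+ : ∀ m n → fromℕ (m ℕ.+ n) ≡ fromℕ m + fromℕ n
fromℕ-+ m n = ℚP.toℚᵘ-injective (begin
  ℚ.toℚᵘ (fromℕ (m ℕ.+ n))                ≈⟨ ℚP.toℚᵘ-fromℚᵘ (integer (m ℕ.+ n)) ⟩
  integer (m ℕ.+ n)                        ≈⟨ ℚᵘ.*≡* numerators ⟩
  integer m ℚᵘ.+ integer n                 ≈⟨ ℚᵘP.+-cong (≃-sym (ℚP.toℚᵘ-fromℚᵘ (integer m)))
                                                         (≃-sym (ℚP.toℚᵘ-fromℚᵘ (integer n))) ⟩
  ℚ.toℚᵘ (fromℕ m) ℚᵘ.+ ℚ.toℚᵘ (fromℕ n)  ≈⟨ ≃-sym (ℚP.toℚᵘ-homo-+ (fromℕ m) (fromℕ n)) ⟩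
  ℚ.toℚᵘ (fromℕ m + fromℕ n)              ∎)
  where
  open import Relation.Binary.Reasoning.Setoid ℚᵘP.≃-setoid
  open import Data.Integer.Tactic.RingSolver using (solve-∀)
  ≃-sym = ℚᵘP.≃-sym
  integer : ℕ → ℚᵘ.ℚᵘ
  integer k = ℚᵘ.mkℚᵘ (ℤ.+ k) 0
  distrib : ∀ x y → (x ℤ.+ y) ℤ.* ℤ.+ 1 ≡ (x ℤ.* ℤ.+ 1 ℤ.+ y ℤ.* ℤ.+ 1) ℤ.* ℤ.+ 1
  distrib = solve-∀
  numerators : ℤ.+ (m ℕ.+ n) ℤ.* ℤ.+ 1 ≡ (ℤ.+ m ℤ.* ℤ.+ 1 ℤ.+ ℤ.+ n ℤ.* ℤ.+ 1) ℤ.* ℤ.+ 1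
  numerators = trans (cong (ℤ._* ℤ.+ 1) (ℤP.pos-+ m n)) (distrib (ℤ.+ m) (ℤ.+ n))

fromℕ-nonNeg : ∀ n → 0ℚ ≤ fromℕ n
fromℕ-nonNeg n = ℚP.nonNegative⁻¹ (fromℕ n) {{ℚP.normalize-nonNeg n 1}}

fromℕ-pos : ∀ n → 0ℚ < fromℕ (suc n)
fromℕ-pos n = ℚP.positive⁻¹ (fromℕ (suc n)) {{ℚP.normalize-pos (suc n) 1}}

fromℕ-mono-≤ : ∀ {m n} → m ℕ.≤ n → fromℕ m ≤ fromℕ n
fromℕ-mono-≤ {m} {n} m≤n = begin
  fromℕ m                       ≡⟨ ℚP.+-identityʳ (fromℕ m) ⟨
  fromℕ m + 0ℚ                  ≤⟨ ℚP.+-monoʳ-≤ (fromℕ m) (fromℕ-nonNeg (n ℕ.∸ m)) ⟩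
  fromℕ m + fromℕ (n ℕ.∸ m)     ≡⟨ fromℕ-+ m (n ℕ.∸ m) ⟨
  fromℕ (m ℕ.+ (n ℕ.∸ m))       ≡⟨ cong fromℕ (ℕP.m+[n∸m]≡n m≤n) ⟩
  fromℕ n                       ∎
  where open ℚP.≤-Reasoning

fromℕ-suc-1 : ∀ n → fromℕ (suc n) - 1ℚ ≡ fromℕ n
fromℕ-suc-1 n = begin
  fromℕ (suc n) - 1ℚ    ≡⟨ cong (_- 1ℚ) (trans (cong fromℕ (ℕP.+-comm 1 n)) (fromℕ-+ n 1)) ⟩
  fromℕ n + 1ℚ - 1ℚ     ≡⟨ solve 1 (λ x → x :+ con 1ℚ :- con 1ℚ := x) refl (fromℕ n) ⟩
  fromℕ n               ∎
  where
  open ≡-Reasoning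
  open +-*-Solver

/₀-pos : ∀ u y (0<y : 0ℚ < y) → u /₀ y ≡ (u * (1/ y) {{ℚP.pos⇒nonZero y {{ℚ.positive 0<y}}}})
/₀-pos u y 0<y with y ℚP.≟ 0ℚ
... | yes y≡0 = contradiction (sym y≡0) (ℚP.<⇒≢ 0<y)
... | no  _   = refl

/₀-cross-≤ : ∀ {u v y z} → 0ℚ < y → 0ℚ < z → u * z ≤ v * y → u /₀ y ≤ v /₀ z
/₀-cross-≤ {u} {v} {y} {z} 0<y 0<z uz≤vy = begin
  u /₀ y                ≡⟨ /₀-pos u y 0<y ⟩
  u * iy                ≡⟨ cancel u z iy iz (ℚP.*-inverseʳ z) ⟨
  (u * z) * (iy * iz)   ≤⟨ ℚP.*-monoʳ-≤-nonNeg (iy * iz) uz≤vy ⟩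
  (v * y) * (iy * iz)   ≡⟨ cong ((v * y) *_) (ℚP.*-comm iy iz) ⟩
  (v * y) * (iz * iy)   ≡⟨ cancel v y iz iy (ℚP.*-inverseʳ y) ⟩
  v * iz                ≡⟨ /₀-pos v z 0<z ⟨
  v /₀ z                ∎
  where
  open ℚP.≤-Reasoning
  instance
    _ = ℚ.positive 0<y
    _ = ℚ.positive 0<z
    _ = ℚP.pos⇒nonZero y
    _ = ℚP.pos⇒nonZero z
  iy = 1/ y
  iz = 1/ z
  instance
    _ : NonNegative (iy * iz)
    _ = ℚP.pos⇒nonNeg (iy * iz) {{ℚP.pos*pos⇒pos iy {{ℚP.1/pos⇒pos y}} iz {{ℚP.1/pos⇒pos z}}}}
  cancel : ∀ a b c d → b * d ≡ 1ℚ → (a * b) * (c * d) ≡ a * c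
  cancel a b c d bd≡1 = begin-equality
    (a * b) * (c * d)   ≡⟨ solve 4 (λ a b c d → (a :* b) :* (c :* d) := (a :* c) :* (b :* d)) refl a b c d ⟩
    (a * c) * (b * d)   ≡⟨ cong ((a * c) *_) bd≡1 ⟩
    (a * c) * 1ℚ        ≡⟨ ℚP.*-identityʳ (a * c) ⟩
    a * c               ∎
    where open +-*-Solver

module _ {p : ℚ} where

  complement-≤ : ½ ≤ p → 1ℚ - p ≤ p
  complement-≤ ½≤p = ℚP.≤-trans (ℚP.+-monoʳ-≤ 1ℚ (ℚP.neg-antimono-≤ ½≤p)) ½≤p

  complement-nonNeg : p ≤ 1ℚ → 0ℚ ≤ 1ℚ - p
  complement-nonNeg p≤1 = ℚP.+-monoʳ-≤ 1ℚ (ℚP.neg-antimono-≤ p≤1)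

  ≥½-pos : ½ ≤ p → 0ℚ < p
  ≥½-pos = ℚP.<-≤-trans (ℚP.positive⁻¹ ½)

ratio-bound : ∀ {p q y z} → 0ℚ ≤ p → q ≤ p → 0ℚ < z → z ≤ y → q /₀ y ≤ p /₀ z
ratio-bound {p} {q} {y} {z} 0≤p q≤p 0<z z≤y =
  /₀-cross-≤ (ℚP.<-≤-trans 0<z z≤y) 0<z (begin
    q * z   ≤⟨ ℚP.*-monoʳ-≤-nonNeg z {{ℚ.nonNegative (ℚP.<⇒≤ 0<z)}} q≤p ⟩
    p * z   ≤⟨ ℚP.*-monoˡ-≤-nonNeg p {{ℚ.nonNegative 0≤p}} z≤y ⟩
    p * y   ∎)
  where open ℚP.≤-Reasoning

weighted-ratio-bound : ∀ {p q A B Y} → 0ℚ ≤ q → q ≤ p → 0ℚ < p →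
  0ℚ ≤ A → 0ℚ < B → A + B ≤ Y → q /₀ Y ≤ (p * q) /₀ (A * q + B * p)
weighted-ratio-bound {p} {q} {A} {B} {Y} 0≤q q≤p 0<p 0≤A 0<B A+B≤Y =
  /₀-cross-≤ 0<Y 0<D (begin
    q * (A * q + B * p)   ≤⟨ ℚP.*-monoˡ-≤-nonNeg q (ℚP.+-monoˡ-≤ (B * p) (ℚP.*-monoˡ-≤-nonNeg A q≤p)) ⟩
    q * (A * p + B * p)   ≡⟨ solve 4 (λ p q A B → q :* (A :* p :+ B :* p) := (p :* q) :* (A :+ B)) refl p q A B ⟩
    (p * q) * (A + B)     ≤⟨ ℚP.*-monoˡ-≤-nonNeg (p * q) A+B≤Y ⟩
    (p * q) * Y           ∎)
  where
  open ℚP.≤-Reasoning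
  open +-*-Solver
  instance
    _ = ℚ.nonNegative 0≤q
    _ = ℚ.nonNegative 0≤A
    _ = ℚ.positive 0<B
    _ = ℚ.positive 0<p
    _ = ℚ.nonNegative (ℚP.<⇒≤ 0<p)
    _ = ℚP.nonNeg*nonNeg⇒nonNeg p q
  0<Y : 0ℚ < Y
  0<Y = ℚP.<-≤-trans (ℚP.positive⁻¹ (A + B) {{ℚP.nonNeg+pos⇒pos A B}}) A+B≤Y
  0<D : 0ℚ < A * q + B * p
  0<D = ℚP.positive⁻¹ (A * q + B * p)
          {{ℚP.nonNeg+pos⇒pos (A * q) {{ℚP.nonNeg*nonNeg⇒nonNeg A q}} (B * p) {{ℚP.pos*pos⇒pos B p}}}}

first-claim : ∀ {L n p} → n ℕ.< L → 1 ℕ.≤ n → ½ ≤ p →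
  (1ℚ - p) /₀ (fromℕ L - 1ℚ) ≤ p /₀ fromℕ n
first-claim {suc L} {suc n} {p} (ℕ.s≤s n<L) _ ½≤p =
  subst (λ y → (1ℚ - p) /₀ y ≤ p /₀ fromℕ (suc n)) (sym (fromℕ-suc-1 L))
    (ratio-bound (ℚP.<⇒≤ (≥½-pos ½≤p)) (complement-≤ ½≤p) (fromℕ-pos n) (fromℕ-mono-≤ n<L))

second-claim : ∀ {L c a p} → 1 ℕ.< c → c ℕ.+ a ℕ.≤ L → ½ ≤ p → p ≤ 1ℚ →
  (1ℚ - p) /₀ (fromℕ L - 1ℚ)
    ≤ (p * (1ℚ - p)) /₀ (fromℕ a * (1ℚ - p) + (fromℕ c - 1ℚ) * p)
second-claim {suc L} {suc (suc c)} {a} {p} (ℕ.s≤s (ℕ.s≤s _)) (ℕ.s≤s c+a≤L) ½≤p p≤1 =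
  subst₂ (λ y b → (1ℚ - p) /₀ y ≤ (p * (1ℚ - p)) /₀ (fromℕ a * (1ℚ - p) + b * p))
    (sym (fromℕ-suc-1 L)) (sym (fromℕ-suc-1 (suc c)))
    (weighted-ratio-bound (complement-nonNeg p≤1) (complement-≤ ½≤p) (≥½-pos ½≤p)
      (fromℕ-nonNeg a) (fromℕ-pos c) a+c≤L)
  where
  a+c≤L : fromℕ a + fromℕ (suc c) ≤ fromℕ L
  a+c≤L = subst (_≤ fromℕ L) (trans (cong fromℕ (ℕP.+-comm (suc c) a)) (fromℕ-+ a (suc c)))
            (fromℕ-mono-≤ c+a≤L)

fact15 : (h t : ℕ) → 1 ℕ.≤ h → 1 ℕ.≤ t →
    ((t ℕ.+ 1) ^ 2 ℕ.+ 1 ℕ.≤ h →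
      (p : ℚ) → ½ ≤ p → p ≤ 1ℚ →
      (1ℚ - p) /₀ (fromℕ (ℓ h t 0) - 1ℚ) ≤ p /₀ fromℕ (t ℕ.+ 1))
    ×
    ((a : ℕ) → 1 ℕ.≤ a → a ℕ.≤ t →
      (t ℕ.+ 1) ℕ.* (t ℕ.+ a) ℕ.+ 1 ℕ.≤ h →
      (p : ℚ) → ½ ≤ p → p ≤ 1ℚ →
      (1ℚ - p) /₀ (fromℕ (ℓ h t 0) - 1ℚ)
        ≤ (p * (1ℚ - p)) /₀ (fromℕ a * (1ℚ - p) + (fromℕ (ℓ h t a) - 1ℚ) * p))
fact15 h t _ 1≤t =
  (λ h>[t+1]² p ½≤p _ →
     first-claim (ℓ₀-large h t h>[t+1]²) (ℕP.m≤n+m 1 t) ½≤p) ,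
  (λ a _ _ h>[t+1][t+a] p ½≤p p≤1 →
     second-claim (ℓₐ-≥2 h t a 1≤t h>[t+1][t+a]) (ℓ-shift h t a h>[t+1][t+a]) ½≤p p≤1)
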